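{- Let $G$ be a connected block graph with vertex set $V$ and blocks $B_1,\ldots,B_r$, and let $V_i=V(B_i)$ for $1\le i\le r$. Then the center sets of $G$ are exactly the singleton sets $\{v\}$, $v\in V$, and the sets $V_1,\ldots,V_r$.
   Context: All graphs are finite, simple and connected; $d$ is shortest-path distance. A block is a maximal induced subgraph without a cut-vertex; a block graph is a graph every block of which is complete. For nonempty $S\subseteq V$, $e_S(v)=\max_{x\in S}d(v,x)$ and $C_S(G)=\{v\in V: e_S(v)\le e_S(x)\ \forall x\in V\}$. A set $A\subseteq V$ is a center set of $G$ if $A=C_S(G)$ for some nonempty $S\subseteq V$. -}

module Defs where

open import Data.Nat using (ℕ; zero; suc; _⊔_; _≤_)
open import Data.Bool using (Bool; true; false; _∧_; _∨_; if_then_else_)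
open import Data.Fin using (Fin; _≟_)
open import Data.Fin.Subset using (Subset; _∈_; _⊆_; _-_; Nonempty)
open import Data.List using (List; foldr; map; allFin)
open import Data.Bool.ListAction using (any)
open import Data.Vec using (lookup)
open import Data.Product using (_×_; ∃)
open import Relation.Nullary.Decidable using (does)
open import Relation.Binary.PropositionalEquality using (_≡_; _≢_)

record Graph (n : ℕ) : Set where
  field
    adj   : Fin n → Fin n → Bool
    sym   : ∀ u v → adj u v ≡ adj v u
    irrefl : ∀ v → adj v v ≡ false
open Graph public

module _ {n : ℕ} (G : Graph n) where

  data WalkIn (B : Subset n) : Fin n → Fin n → Set where
    nil  : ∀ {u} → u ∈ B → WalkIn B u u
    cons : ∀ {u w v} → u ∈ B → adj G u w ≡ true → WalkIn B w v → WalkIn B u v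

  -- the induced subgraph G[B] is connected (vacuous for B empty)
  ConnectedOn : Subset n → Set
  ConnectedOn B = ∀ u v → u ∈ B → v ∈ B → WalkIn B u v

  Connected : Set
  Connected = ∀ u v → WalkIn (Data.Fin.Subset.⊤) u v

  NoCutVertex : Subset n → Set
  NoCutVertex B = ∀ w → w ∈ B → ConnectedOn (B - w)

  IsBlock : Subset n → Set
  IsBlock B = (ConnectedOn B × NoCutVertex B)
            × (∀ B′ → B ⊆ B′ → ConnectedOn B′ → NoCutVertex B′ → B′ ⊆ B)

  IsBlockGraph : Set
  IsBlockGraph = ∀ B → IsBlock B → ∀ u v → u ∈ B → v ∈ B → u ≢ v → adj G u v ≡ true

  reach : ℕ → Fin n → Fin n → Bool
  reach zero    u v = does (u ≟ v)
  reach (suc k) u v = reach k u v ∨ any (λ w → adj G u w ∧ reach k w v) (allFin n)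

  -- least k ≤ N with f k, or N if there is none
  least : (ℕ → Bool) → ℕ → ℕ
  least f zero    = zero
  least f (suc N) = if f zero then zero else suc (least (λ k → f (suc k)) N)

  -- shortest-path distance (exact for connected G, since d < n)
  dist : Fin n → Fin n → ℕ
  dist u v = least (λ k → reach k u v) n

  ecc : Subset n → Fin n → ℕ
  ecc S v = foldr _⊔_ zero (map (λ x → if lookup S x then dist v x else zero) (allFin n))

  InCenter : Subset n → Fin n → Set
  InCenter S v = ∀ x → ecc S v ≤ ecc S x

  IsCenterSet : Subset n → Set
  IsCenterSet A = ∃ λ S → Nonempty S × (∀ v → (v ∈ A → InCenter S v) × (InCenter S v → v ∈ A))

module Submission where

-- Fix a vertex x and call dist y x the level of y. In a block graph every simple cycle spans a
-- clique, so one-level descents from the two ends of a simple path lying above them meet in a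
-- common vertex. Hence every vertex other than x has a unique neighbor one level closer to x, and
-- along a geodesic whose first step does not descend, the level increases at every further step.
-- If two vertices u, w of C_S(G) were non-adjacent, the neighbor of u on a geodesic to w would
-- have smaller eccentricity than u; so C_S(G) is a clique. A common neighbor of two adjacent
-- centers lying farther than both from some x ∈ S would have two parents towards x, so C_S(G) is
-- a singleton or a maximal clique, and in a block graph the maximal cliques are the blocks.
-- Conversely {v} = C_{v}(G), and a block B with two vertices is C_B(G): its vertices have
-- eccentricity 1 and all other vertices at least 2.

open import Defs hiding (sym)
open import Data.Nat using (ℕ; zero; suc; _+_; _∸_; _≤_; _<_; z≤n; s≤s; _≤?_)
open import Data.Nat.Properties
  using (≤-refl; ≤-reflexive; ≤-trans; <-≤-trans; ≤-pred; ≤-antisym; <-irrefl; <-cmp; ≰⇒>; <⇒≤;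
         n≤1+n; n≤0⇒n≡0; suc-injective; ∸-monoʳ-<; +-suc; +-identityʳ; m<m+n;
         ⊔-lub; m≤n⇒m≤n⊔o; m≤n⇒m≤o⊔n; module ≤-Reasoning)
open import Data.Bool using (Bool; true; false; T; _∧_; if_then_else_)
open import Data.Bool.Properties using (T-≡; T-∧; T-∨) renaming (_≟_ to _≟ᵇ_)
open import Data.Fin using (Fin; zero; _≟_)
open import Data.Fin.Properties using (any?; all?)
open import Data.Fin.Subset
  using (Subset; Nonempty; _∈_; _∉_; _⊆_; _─_; _-_; _∪_; ⁅_⁆; ⋃; ∣_∣; outside; ⊤)
open import Data.Fin.Subset.Properties
  using (_∈?_; _⊂?_; nonempty?; anySubset?; x∈p∧x≢y⇒x∈p-y; p─q⊆p; x∈p⇒∣p-x∣<∣p∣; p⊂q⇒p⊆q;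
         p⊂q⇒∣p∣<∣q∣; ∣p∣≤n; ⊆-refl; ⊆-trans; ⊆-antisym; x∉⁅y⁆⇒x≢y; x∈⁅x⁆; x∈⁅y⁆⇒x≡y;
         x∈p∪q⁺; x∈p∪q⁻; p⊆p∪q; ∉⊥)
open import Data.Vec using (_∷_; here; there; lookup)
open import Data.Vec.Properties using ([]=⇒lookup; lookup⇒[]=)
open import Data.List using (List; []; _∷_; _∷ʳ_; map; allFin)
open import Data.List.Properties using (foldr-preservesᵇ; foldr-preservesᵒ)
open import Data.List.Extrema.Nat using (argmin; f[argmin]≤f[xs])
open import Data.List.Membership.Propositional using (lose) renaming (_∈_ to _∈ₗ_)
open import Data.List.Membership.Propositional.Properties using (∈-allFin; ∈-++⁺ˡ)
import Data.List.Relation.Unary.Any as Any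
import Data.List.Relation.Unary.Any.Properties as Any
import Data.List.Relation.Unary.All as All
import Data.List.Relation.Unary.All.Properties as All
open import Data.List.Relation.Unary.All using (All)
open import Data.List.Relation.Unary.AllPairs using ([]; _∷_)
open import Data.List.Relation.Unary.Unique.Propositional using (Unique)
import Data.List.Relation.Unary.Unique.Propositional.Properties as Unique
open import Data.Product using (_×_; _,_; ∃; proj₁; proj₂)
open import Data.Sum using (_⊎_; inj₁; inj₂; [_,_]′)
open import Data.Empty using (⊥-elim)
open import Function using (_∘_; Equivalence)
open Equivalence using (to; from)
open import Relation.Binary using (tri<; tri≈; tri>)
open import Relation.Binary.PropositionalEquality
  using (_≡_; _≢_; refl; sym; trans; subst; cong; module ≡-Reasoning)
open import Relation.Nullary using (¬_; Dec; yes; no)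
open import Relation.Nullary.Decidable using (_×-dec_; _→-dec_; ¬?; decidable-stable)

x∈p─q⇒x∉q : ∀ {m} {x : Fin m} (p q : Subset m) → x ∈ p ─ q → x ∉ q
x∈p─q⇒x∉q (_ ∷ p) (outside ∷ q) here ()
x∈p─q⇒x∉q (_ ∷ p) (_ ∷ q) (there x∈) (there x∈q) = x∈p─q⇒x∉q p q x∈ x∈q

x∈p-y⇒x∈p : ∀ {m} {x y : Fin m} {p : Subset m} → x ∈ p - y → x ∈ p
x∈p-y⇒x∈p {y = y} {p} = p─q⊆p p ⁅ y ⁆

x∈p-y⇒x≢y : ∀ {m} {x y : Fin m} {p : Subset m} → x ∈ p - y → x ≢ y
x∈p-y⇒x≢y {y = y} {p} x∈ = x∉⁅y⁆⇒x≢y (x∈p─q⇒x∉q p ⁅ y ⁆ x∈)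

singleton⊎another : ∀ {m} {A : Subset m} {u} → u ∈ A → A ≡ ⁅ u ⁆ ⊎ ∃ λ w → w ∈ A × w ≢ u
singleton⊎another {A = A} {u} u∈A with any? (λ w → (w ∈? A) ×-dec ¬? (w ≟ u))
... | yes another = inj₂ another
... | no ¬another = inj₁ (⊆-antisym A⊆⁅u⁆ ⁅u⁆⊆A)
  where
  A⊆⁅u⁆ : A ⊆ ⁅ u ⁆
  A⊆⁅u⁆ {w} w∈A with w ≟ u
  ... | yes refl = x∈⁅x⁆ u
  ... | no w≢u = ⊥-elim (¬another (w , w∈A , w≢u))
  ⁅u⁆⊆A : ⁅ u ⁆ ⊆ A
  ⁅u⁆⊆A w∈⁅u⁆ with refl ← x∈⁅y⁆⇒x≡y u w∈⁅u⁆ = u∈A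

unique-∷-∷ʳ : ∀ {A : Set} {x y : A} {xs} → Unique xs → All (x ≢_) xs → All (y ≢_) xs → x ≢ y →
              Unique (x ∷ xs ∷ʳ y)
unique-∷-∷ʳ {y = y} simple x∉ y∉ x≢y =
  All.++⁺ x∉ (x≢y All.∷ All.[]) ∷
  Unique.++⁺ simple (All.[] ∷ []) λ { (v∈ , Any.here refl) → All.lookup y∉ v∈ refl }

module Connectivity {n : ℕ} (G : Graph n) where

  Adj : Fin n → Fin n → Set
  Adj u v = adj G u v ≡ true

  adj-sym : ∀ {u v} → Adj u v → Adj v u
  adj-sym {u} {v} = trans (Graph.sym G v u)

  adj⇒≢ : ∀ {u v} → Adj u v → u ≢ v
  adj⇒≢ {u} e refl with () ← trans (sym e) (irrefl G u)

  adj? : ∀ u v → Dec (Adj u v)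
  adj? u v = adj G u v ≟ᵇ true

  source∈ : ∀ {B u v} → WalkIn G B u v → u ∈ B
  source∈ (nil u∈) = u∈
  source∈ (cons u∈ _ _) = u∈

  target∈ : ∀ {B u v} → WalkIn G B u v → v ∈ B
  target∈ (nil v∈) = v∈
  target∈ (cons _ _ r) = target∈ r

  walk-⊆ : ∀ {B B′ u v} → B ⊆ B′ → WalkIn G B u v → WalkIn G B′ u v
  walk-⊆ B⊆ (nil u∈) = nil (B⊆ u∈)
  walk-⊆ B⊆ (cons u∈ e r) = cons (B⊆ u∈) e (walk-⊆ B⊆ r)

  walk-++ : ∀ {B u v w} → WalkIn G B u v → WalkIn G B v w → WalkIn G B u w
  walk-++ (nil _) q = q
  walk-++ (cons u∈ e r) q = cons u∈ e (walk-++ r q)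

  walk-reverse : ∀ {B u v} → WalkIn G B u v → WalkIn G B v u
  walk-reverse (nil u∈) = nil u∈
  walk-reverse (cons u∈ e r) =
    walk-++ (walk-reverse r) (cons (source∈ r) (adj-sym e) (nil u∈))

  walk-avoid : ∀ {B a v} t → t ≢ v → WalkIn G B a v →
               WalkIn G (B - t) a v ⊎ ∃ λ w → Adj t w × WalkIn G (B - t) w v
  walk-avoid t t≢v (nil a∈) = inj₁ (nil (x∈p∧x≢y⇒x∈p-y a∈ (λ a≡t → t≢v (sym a≡t))))
  walk-avoid {a = a} t t≢v (cons {w = w} a∈ e r) with walk-avoid t t≢v r
  ... | inj₂ later = inj₂ later
  ... | inj₁ r′ with a ≟ t
  ...   | yes refl = inj₂ (w , e , r′)
  ...   | no a≢t = inj₁ (cons (x∈p∧x≢y⇒x∈p-y a∈ a≢t) e r′)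

  walkIn? : ∀ B u v → Dec (WalkIn G B u v)
  walkIn? B = bounded (suc ∣ B ∣) B ≤-refl
    where
    bounded : ∀ k B → ∣ B ∣ < k → ∀ u v → Dec (WalkIn G B u v)
    bounded (suc k) B ∣B∣<k u v with u ∈? B
    ... | no u∉B = no (λ r → u∉B (source∈ r))
    ... | yes u∈B with u ≟ v
    ...   | yes refl = yes (nil u∈B)
    ...   | no u≢v with any? (λ w → adj? u w ×-dec bounded k (B - u) ∣B-u∣<k w v)
      where ∣B-u∣<k = <-≤-trans (x∈p⇒∣p-x∣<∣p∣ u∈B) (≤-pred ∣B∣<k)
    ...     | yes (w , e , r) = yes (cons u∈B e (walk-⊆ (p─q⊆p B ⁅ u ⁆) r))
    ...     | no ¬step = no λ r → [ (λ r′ → x∈p-y⇒x≢y (source∈ r′) refl) , ¬step ]′ (walk-avoid u u≢v r)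

  connectedOn? : ∀ B → Dec (ConnectedOn G B)
  connectedOn? B = all? λ u → all? λ v → (u ∈? B) →-dec ((v ∈? B) →-dec walkIn? B u v)

  noCutVertex? : ∀ B → Dec (NoCutVertex G B)
  noCutVertex? B = all? λ w → (w ∈? B) →-dec connectedOn? (B - w)

  TwoConnected : Subset n → Set
  TwoConnected B = ConnectedOn G B × NoCutVertex G B

  twoConnected⇒⊆block : ∀ {B} → TwoConnected B → ∃ λ B′ → IsBlock G B′ × B ⊆ B′
  twoConnected⇒⊆block {B} = grow (suc (n ∸ ∣ B ∣)) B ≤-refl
    where
    grow : ∀ k B → n ∸ ∣ B ∣ < k → TwoConnected B → ∃ λ B′ → IsBlock G B′ × B ⊆ B′
    grow (suc k) B room tc
      with anySubset? (λ B′ → (B ⊂? B′) ×-dec (connectedOn? B′ ×-dec noCutVertex? B′))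
    ... | yes (B′ , B⊂B′ , tc′) with grow k B′ room′ tc′
      where room′ = <-≤-trans (∸-monoʳ-< (p⊂q⇒∣p∣<∣q∣ B⊂B′) (∣p∣≤n B′)) (≤-pred room)
    ...   | B″ , block , B′⊆B″ = B″ , block , ⊆-trans (p⊂q⇒p⊆q B⊂B′) B′⊆B″
    grow (suc k) B room tc | no ¬bigger = B , (tc , maximal) , ⊆-refl
      where
      maximal : ∀ B′ → B ⊆ B′ → ConnectedOn G B′ → NoCutVertex G B′ → B′ ⊆ B
      maximal B′ B⊆B′ c nc {x} x∈B′ with x ∈? B
      ... | yes x∈B = x∈B
      ... | no x∉B = ⊥-elim (¬bigger (B′ , (B⊆B′ , x , x∈B′ , x∉B) , c , nc))

  Clique : Subset n → Set
  Clique K = ∀ u v → u ∈ K → v ∈ K → u ≢ v → Adj u v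

  clique-⊆ : ∀ {K K′} → K′ ⊆ K → Clique K → Clique K′
  clique-⊆ K′⊆K cl u v u∈ v∈ = cl u v (K′⊆K u∈) (K′⊆K v∈)

  clique⇒≡⊎adj : ∀ {K u v} → Clique K → u ∈ K → v ∈ K → u ≡ v ⊎ Adj u v
  clique⇒≡⊎adj {u = u} {v} cl u∈ v∈ with u ≟ v
  ... | yes u≡v = inj₁ u≡v
  ... | no u≢v = inj₂ (cl u v u∈ v∈ u≢v)

  clique⇒connectedOn : ∀ {K} → Clique K → ConnectedOn G K
  clique⇒connectedOn cl u v u∈ v∈ with clique⇒≡⊎adj cl u∈ v∈
  ... | inj₁ refl = nil u∈
  ... | inj₂ e = cons u∈ e (nil v∈)

  clique⇒twoConnected : ∀ {K} → Clique K → TwoConnected K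
  clique⇒twoConnected {K} cl =
    clique⇒connectedOn cl , λ t _ → clique⇒connectedOn (clique-⊆ (p─q⊆p K ⁅ t ⁆) cl)

  infixr 5 _∷ₚ_
  data Path : Fin n → Fin n → Set where
    []ₚ  : ∀ {u} → Path u u
    _∷ₚ_ : ∀ {u w v} → Adj u w → Path w v → Path u v

  vertices : ∀ {u v} → Path u v → List (Fin n)
  vertices ([]ₚ {u}) = u ∷ []
  vertices (_∷ₚ_ {u} _ p) = u ∷ vertices p

  source∈vertices : ∀ {u v} (p : Path u v) → u ∈ₗ vertices p
  source∈vertices []ₚ = Any.here refl
  source∈vertices (_ ∷ₚ _) = Any.here refl

  target∈vertices : ∀ {u v} (p : Path u v) → v ∈ₗ vertices p
  target∈vertices []ₚ = Any.here refl
  target∈vertices (_ ∷ₚ p) = Any.there (target∈vertices p)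

  path-snoc : ∀ {u v w} → Path u v → Adj v w → Path u w
  path-snoc []ₚ e = e ∷ₚ []ₚ
  path-snoc (e′ ∷ₚ p) e = e′ ∷ₚ path-snoc p e

  vertices-snoc : ∀ {u v w} (p : Path u v) (e : Adj v w) → vertices (path-snoc p e) ≡ vertices p ∷ʳ w
  vertices-snoc []ₚ e = refl
  vertices-snoc (e′ ∷ₚ p) e = cong (_ ∷_) (vertices-snoc p e)

  PairwiseAdjacent : List (Fin n) → Set
  PairwiseAdjacent ys = ∀ {y z} → y ∈ₗ ys → z ∈ₗ ys → y ≢ z → Adj y z

  path-prefix : ∀ {Y u v x} (p : Path u v) → All (_∈ Y) (vertices p) →
                x ∈ₗ vertices p → WalkIn G Y u x
  path-prefix []ₚ (u∈ All.∷ _) (Any.here refl) = nil u∈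
  path-prefix (_ ∷ₚ _) (u∈ All.∷ _) (Any.here refl) = nil u∈
  path-prefix (e ∷ₚ p) (u∈ All.∷ rest) (Any.there x∈) = cons u∈ e (path-prefix p rest x∈)

  path-suffix : ∀ {Y u v x} (p : Path u v) → All (_∈ Y) (vertices p) →
                x ∈ₗ vertices p → WalkIn G Y x v
  path-suffix []ₚ (u∈ All.∷ _) (Any.here refl) = nil u∈
  path-suffix (e ∷ₚ p) (u∈ All.∷ rest) (Any.here refl) =
    cons u∈ e (path-suffix p rest (source∈vertices p))
  path-suffix (e ∷ₚ p) (_ All.∷ rest) (Any.there x∈) = path-suffix p rest x∈

  -- t occurs at most once on a simple path, so it misses the part before x or the part after x.
  path-avoid : ∀ {Y u v x} t (p : Path u v) → Unique (vertices p) →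
               All (_∈ Y) (vertices p) → x ∈ₗ vertices p → x ≢ t →
               WalkIn G (Y - t) u x ⊎ WalkIn G (Y - t) x v
  path-avoid t []ₚ _ (u∈ All.∷ _) (Any.here refl) x≢t = inj₁ (nil (x∈p∧x≢y⇒x∈p-y u∈ x≢t))
  path-avoid t (_ ∷ₚ _) _ (u∈ All.∷ _) (Any.here refl) x≢t = inj₁ (nil (x∈p∧x≢y⇒x∈p-y u∈ x≢t))
  path-avoid {Y} {u = u} t (e ∷ₚ p) (u∉p ∷ simple) (u∈ All.∷ rest) (Any.there x∈) x≢t
    with path-avoid t p simple rest x∈ x≢t
  ... | inj₂ after = inj₂ after
  ... | inj₁ before with u ≟ t
  ...   | no u≢t = inj₁ (cons (x∈p∧x≢y⇒x∈p-y u∈ u≢t) e before)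
  ...   | yes refl = inj₂ (path-suffix p rest-t x∈)
    where
    rest-t : All (_∈ Y - t) (vertices p)
    rest-t = All.zipWith (λ (y∈ , t≢y) → x∈p∧x≢y⇒x∈p-y y∈ (t≢y ∘ sym)) (rest , u∉p)

  vertexSet : List (Fin n) → Subset n
  vertexSet xs = ⋃ (map ⁅_⁆ xs)

  ∈ₗ⇒∈vertexSet : ∀ {x xs} → x ∈ₗ xs → x ∈ vertexSet xs
  ∈ₗ⇒∈vertexSet (Any.here refl) = x∈p∪q⁺ (inj₁ (x∈⁅x⁆ _))
  ∈ₗ⇒∈vertexSet (Any.there x∈) = x∈p∪q⁺ (inj₂ (∈ₗ⇒∈vertexSet x∈))

  ∈vertexSet⇒∈ₗ : ∀ {x} xs → x ∈ vertexSet xs → x ∈ₗ xs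
  ∈vertexSet⇒∈ₗ [] x∈ = ⊥-elim (∉⊥ x∈)
  ∈vertexSet⇒∈ₗ (y ∷ xs) x∈ with x∈p∪q⁻ ⁅ y ⁆ (vertexSet xs) x∈
  ... | inj₁ x∈⁅y⁆ = Any.here (x∈⁅y⁆⇒x≡y y x∈⁅y⁆)
  ... | inj₂ x∈xs = Any.there (∈vertexSet⇒∈ₗ xs x∈xs)

  cycle⇒twoConnected : ∀ {a b} (p : Path a b) → Unique (vertices p) → Adj b a →
                       TwoConnected (vertexSet (vertices p))
  cycle⇒twoConnected {a} {b} p simple ba = connected , noCut
    where
    Y = vertexSet (vertices p)
    onY : All (_∈ Y) (vertices p)
    onY = All.tabulate ∈ₗ⇒∈vertexSet
    connected : ConnectedOn G Y
    connected u v u∈ v∈ = walk-++ (walk-reverse (path-prefix p onY (∈vertexSet⇒∈ₗ _ u∈)))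
                                  (path-prefix p onY (∈vertexSet⇒∈ₗ _ v∈))
    noCut : NoCutVertex G Y
    noCut t _ u v u∈ v∈ = join (avoid u∈) (avoid v∈)
      where
      avoid : ∀ {x} → x ∈ Y - t → WalkIn G (Y - t) a x ⊎ WalkIn G (Y - t) x b
      avoid x∈ = path-avoid t p simple onY (∈vertexSet⇒∈ₗ _ (x∈p-y⇒x∈p x∈)) (x∈p-y⇒x≢y x∈)
      join : WalkIn G (Y - t) a u ⊎ WalkIn G (Y - t) u b →
             WalkIn G (Y - t) a v ⊎ WalkIn G (Y - t) v b → WalkIn G (Y - t) u v
      join (inj₁ au) (inj₁ av) = walk-++ (walk-reverse au) av
      join (inj₁ au) (inj₂ vb) =
        walk-++ (walk-reverse au) (cons (source∈ au) (adj-sym ba) (walk-reverse vb))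
      join (inj₂ ub) (inj₁ av) = walk-++ ub (cons (target∈ ub) ba av)
      join (inj₂ ub) (inj₂ vb) = walk-++ ub (walk-reverse vb)

  AdjacentToAll : Subset n → Fin n → Set
  AdjacentToAll A y = ∀ a → a ∈ A → y ≢ a → Adj y a

  MaximalClique : Subset n → Set
  MaximalClique A = Clique A × (∀ y → AdjacentToAll A y → y ∈ A)

  clique-∪-⁅⁆ : ∀ {A y} → Clique A → AdjacentToAll A y → Clique (A ∪ ⁅ y ⁆)
  clique-∪-⁅⁆ {A} {y} cl y~A u v u∈ v∈ u≢v with x∈p∪q⁻ A ⁅ y ⁆ u∈ | x∈p∪q⁻ A ⁅ y ⁆ v∈
  ... | inj₁ u∈A | inj₁ v∈A = cl u v u∈A v∈A u≢v
  ... | inj₁ u∈A | inj₂ v∈y with refl ← x∈⁅y⁆⇒x≡y y v∈y = adj-sym (y~A u u∈A (λ y≡u → u≢v (sym y≡u)))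
  ... | inj₂ u∈y | inj₁ v∈A with refl ← x∈⁅y⁆⇒x≡y y u∈y = y~A v v∈A u≢v
  ... | inj₂ u∈y | inj₂ v∈y = ⊥-elim (u≢v (trans (x∈⁅y⁆⇒x≡y y u∈y) (sym (x∈⁅y⁆⇒x≡y y v∈y))))

  nonNeighbor : ∀ {A y} → ¬ AdjacentToAll A y → ∃ λ a → a ∈ A × y ≢ a × ¬ Adj y a
  nonNeighbor {A} {y} ¬y~A with any? (λ a → (a ∈? A) ×-dec ¬? (y ≟ a) ×-dec ¬? (adj? y a))
  ... | yes found = found
  ... | no ¬found = ⊥-elim (¬y~A λ a a∈A y≢a →
                      decidable-stable (adj? y a) (λ y≁a → ¬found (a , a∈A , y≢a , y≁a)))

module BlockGraph {n : ℕ} (G : Graph n) (blockGraph : IsBlockGraph G) where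
  open Connectivity G

  twoConnected⇒clique : ∀ {X} → TwoConnected X → Clique X
  twoConnected⇒clique tc u v u∈ v∈ u≢v with B , block , X⊆B ← twoConnected⇒⊆block tc =
    blockGraph B block u v (X⊆B u∈) (X⊆B v∈) u≢v

  cycle⇒clique : ∀ {a b} (p : Path a b) → Unique (vertices p) → Adj b a →
                 PairwiseAdjacent (vertices p)
  cycle⇒clique p simple ba x∈ y∈ =
    twoConnected⇒clique (cycle⇒twoConnected p simple ba) _ _ (∈ₗ⇒∈vertexSet x∈) (∈ₗ⇒∈vertexSet y∈)

  block⇒maximalClique : ∀ {A} → IsBlock G A → MaximalClique A
  block⇒maximalClique {A} block@(_ , maximal) = clique , grow
    where
    clique : Clique A
    clique = blockGraph A block
    grow : ∀ y → AdjacentToAll A y → y ∈ A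
    grow y y~A = let (c , nc) = clique⇒twoConnected (clique-∪-⁅⁆ clique y~A) in
      maximal (A ∪ ⁅ y ⁆) (p⊆p∪q ⁅ y ⁆) c nc (x∈p∪q⁺ (inj₂ (x∈⁅x⁆ y)))

  maximalClique⇒block : ∀ {A} → MaximalClique A → IsBlock G A
  maximalClique⇒block {A} (clique , grow) = clique⇒twoConnected clique , maximal
    where
    maximal : ∀ B → A ⊆ B → ConnectedOn G B → NoCutVertex G B → B ⊆ A
    maximal B A⊆B c nc {y} y∈B =
      grow y (λ a a∈A → twoConnected⇒clique (c , nc) y a y∈B (A⊆B a∈A))

module Distance {n : ℕ} (G : Graph n) (connected : Connected G) where
  open Connectivity G

  Reach : ℕ → Fin n → Fin n → Set
  Reach k u v = T (reach G k u v)

  reach-zero⇒≡ : ∀ {u v} → Reach 0 u v → u ≡ v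
  reach-zero⇒≡ {u} {v} r with u ≟ v
  ... | yes u≡v = u≡v

  reach-refl : ∀ k u → Reach k u u
  reach-refl zero u with u ≟ u
  ... | yes _ = _
  ... | no u≢u = u≢u refl
  reach-refl (suc k) u = T-∨ .from (inj₁ (reach-refl k u))

  reach-step : ∀ {k u w v} → Adj u w → Reach k w v → Reach (suc k) u v
  reach-step {k} {u} {w} {v} e r =
    T-∨ .from (inj₂ (Any.any⁺ (λ w → adj G u w ∧ reach G k w v)
                               (lose (∈-allFin w) (T-∧ .from (T-≡ .from e , r)))))

  reach-suc⁻ : ∀ {k u v} → Reach (suc k) u v → Reach k u v ⊎ ∃ λ w → Adj u w × Reach k w v
  reach-suc⁻ {k} {u} {v} r with T-∨ .to r
  ... | inj₁ r′ = inj₁ r′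
  ... | inj₂ viaNeighbor
    with w , e∧r ← Any.satisfied (Any.any⁻ (λ w → adj G u w ∧ reach G k w v) (allFin n) viaNeighbor) =
    let (e , r′) = T-∧ .to e∧r in inj₂ (w , T-≡ .to e , r′)

  walk⇒reach : ∀ k {B u v} → WalkIn G B u v → ∣ B ∣ ≤ suc k → Reach k u v
  walk⇒reach k {u = u} {v} r ∣B∣≤ with u ≟ v
  ... | yes refl = reach-refl k u
  ... | no u≢v with walk-avoid u u≢v r
  ...   | inj₁ r′ = ⊥-elim (x∈p-y⇒x≢y (source∈ r′) refl)
  ...   | inj₂ (w , e , r′) with k | ≤-trans (x∈p⇒∣p-x∣<∣p∣ (source∈ r)) ∣B∣≤
  ...     | zero  | ∣B-u∣<1 with s≤s () ← ≤-trans (s≤s (x∈p⇒∣p-x∣<∣p∣ (source∈ r′))) ∣B-u∣<1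
  ...     | suc k | ∣B-u∣<k = reach-step {k} e (walk⇒reach k r′ (≤-pred ∣B-u∣<k))

  least-≤ : ∀ (f : ℕ → Bool) N k → T (f k) → least G f N ≤ k
  least-≤ f zero    k       _  = z≤n
  least-≤ f (suc N) zero    f0 with f 0
  ... | true  = z≤n
  ... | false = ⊥-elim f0
  least-≤ f (suc N) (suc k) fk with f 0
  ... | true  = z≤n
  ... | false = s≤s (least-≤ (f ∘ suc) N k fk)

  least-satisfies : ∀ (f : ℕ → Bool) N k → k ≤ N → T (f k) → T (f (least G f N))
  least-satisfies f zero    zero    _   fk = fk
  least-satisfies f (suc N) k       k≤N fk with f 0 in f0
  ... | true = subst T (sym f0) _
  least-satisfies f (suc N) zero    _   f0′ | false = ⊥-elim (subst T f0 f0′)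
  least-satisfies f (suc N) (suc k) k≤N fk | false = least-satisfies (f ∘ suc) N k (≤-pred k≤N) fk

  reach-within-n : ∀ u v → Reach n u v
  reach-within-n u v = walk⇒reach n (connected u v) (≤-trans (∣p∣≤n ⊤) (n≤1+n n))

  reach-dist : ∀ u v → Reach (dist G u v) u v
  reach-dist u v = least-satisfies (λ k → reach G k u v) n n ≤-refl (reach-within-n u v)

  dist-minimal : ∀ {k u v} → Reach k u v → dist G u v ≤ k
  dist-minimal {k} {u} {v} = least-≤ (λ k → reach G k u v) n k

  dist-refl : ∀ u → dist G u u ≡ 0
  dist-refl u = n≤0⇒n≡0 (dist-minimal (reach-refl 0 u))

  dist≡0⇒≡ : ∀ {u v} → dist G u v ≡ 0 → u ≡ v
  dist≡0⇒≡ {u} {v} d≡0 = reach-zero⇒≡ (subst (λ k → Reach k u v) d≡0 (reach-dist u v))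

  dist-adj-≤ : ∀ {u w} x → Adj u w → dist G u x ≤ suc (dist G w x)
  dist-adj-≤ {w = w} x e = dist-minimal (reach-step {dist G w x} e (reach-dist w x))

  dist-suc⇒adj : ∀ {u x k} → dist G u x ≡ suc k → ∃ λ w → Adj u w × dist G w x ≡ k
  dist-suc⇒adj {u} {x} {k} d≡ with reach-suc⁻ {k} (subst (λ j → Reach j u x) d≡ (reach-dist u x))
  ... | inj₁ r = ⊥-elim (<-irrefl refl (subst (_≤ k) d≡ (dist-minimal r)))
  ... | inj₂ (w , e , r) =
    w , e , ≤-antisym (dist-minimal r) (≤-pred (subst (_≤ suc (dist G w x)) d≡ (dist-adj-≤ x e)))

  dist≡1⇒adj : ∀ {u v} → dist G u v ≡ 1 → Adj u v
  dist≡1⇒adj d≡1 with w , e , d≡0 ← dist-suc⇒adj d≡1 with refl ← dist≡0⇒≡ d≡0 = e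

  ≢⇒dist>0 : ∀ {u v} → u ≢ v → 0 < dist G u v
  ≢⇒dist>0 {u} {v} u≢v with dist G u v in d≡
  ... | zero  = ⊥-elim (u≢v (dist≡0⇒≡ d≡))
  ... | suc _ = s≤s z≤n

  adj⇒dist≡1 : ∀ {u v} → Adj u v → dist G u v ≡ 1
  adj⇒dist≡1 {u} {v} e =
    ≤-antisym (dist-minimal (reach-step {0} e (reach-refl 0 v))) (≢⇒dist>0 (adj⇒≢ e))

  ≡⊎adj⇒dist≤1 : ∀ {u v} → u ≡ v ⊎ Adj u v → dist G u v ≤ 1
  ≡⊎adj⇒dist≤1 (inj₁ refl) = ≤-trans (≤-reflexive (dist-refl _)) z≤n
  ≡⊎adj⇒dist≤1 (inj₂ e) = ≤-reflexive (adj⇒dist≡1 e)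

  ≢∧¬adj⇒dist≥2 : ∀ {u v} → u ≢ v → ¬ Adj u v → 2 ≤ dist G u v
  ≢∧¬adj⇒dist≥2 {u} {v} u≢v u≁v with dist G u v in d≡
  ... | zero        = ⊥-elim (u≢v (dist≡0⇒≡ d≡))
  ... | suc zero    = ⊥-elim (u≁v (dist≡1⇒adj d≡))
  ... | suc (suc _) = s≤s (s≤s z≤n)

module Levels {n : ℕ} (G : Graph n) (connected : Connected G) (blockGraph : IsBlockGraph G)
              (x : Fin n) where
  open Connectivity G
  open BlockGraph G blockGraph
  open Distance G connected

  level : Fin n → ℕ
  level y = dist G y x

  lower⇒≢ : ∀ {k y z} → level y ≡ k → k < level z → y ≢ z
  lower⇒≢ ly k<lz refl = <-irrefl (sym ly) k<lz

  adj⇒level≤ : ∀ {u w} → Adj u w → level u ≤ suc (level w)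
  adj⇒level≤ = dist-adj-≤ x

  -- If a′ = b′, the path closes into a cycle, which spans a clique. Otherwise extend p to
  -- b′ ∷ p ∷ʳ a′ and descend once more: by induction a becomes adjacent to a vertex two levels
  -- below it.
  descents-meet : ∀ k {a b a′ b′} (p : Path b a) → Unique (vertices p) →
                  All (λ y → k < level y) (vertices p) →
                  level a ≡ suc k → Adj a a′ → Adj b b′ → level a′ ≡ k → level b′ ≡ k →
                  a′ ≡ b′ × PairwiseAdjacent (b′ ∷ vertices p)
  descents-meet k {a′ = a′} {b′} p simple high la aa′ bb′ la′ lb′ with a′ ≟ b′
  ... | yes refl = refl , cycle⇒clique (adj-sym bb′ ∷ₚ p) (All.map (lower⇒≢ lb′) high ∷ simple) aa′
  descents-meet zero p simple high la aa′ bb′ la′ lb′ | no a′≢b′ =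
    ⊥-elim (a′≢b′ (trans (dist≡0⇒≡ la′) (sym (dist≡0⇒≡ lb′))))
  descents-meet (suc k) {a} {b} {a′} {b′} p simple high la aa′ bb′ la′ lb′ | no a′≢b′
    with a″ , a′a″ , la″ ← dist-suc⇒adj la′ | b″ , b′b″ , lb″ ← dist-suc⇒adj lb′ =
    ⊥-elim (<-irrefl refl (subst (_≤ suc k) la (subst (λ l → level a ≤ suc l) lb″ (adj⇒level≤ a~b″))))
    where
    p′ : Path b′ a′
    p′ = adj-sym bb′ ∷ₚ path-snoc p aa′
    vertices-p′ : vertices p′ ≡ b′ ∷ vertices p ∷ʳ a′
    vertices-p′ = cong (b′ ∷_) (vertices-snoc p aa′)
    simple′ : Unique (vertices p′)
    simple′ = subst Unique (sym vertices-p′)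
      (unique-∷-∷ʳ simple (All.map (lower⇒≢ lb′) high) (All.map (lower⇒≢ la′) high) (a′≢b′ ∘ sym))
    high′ : All (λ y → k < level y) (vertices p′)
    high′ = subst (All _) (sym vertices-p′)
      (≤-reflexive (sym lb′) All.∷
       All.++⁺ (All.map (≤-trans (n≤1+n _)) high) (≤-reflexive (sym la′) All.∷ All.[]))
    a∈p′ : a ∈ₗ vertices p′
    a∈p′ = subst (a ∈ₗ_) (sym vertices-p′) (Any.there (∈-++⁺ˡ (target∈vertices p)))
    a~b″ : Adj a b″
    a~b″ = proj₂ (descents-meet k p′ simple′ high′ la′ a′a″ b′b″ la″ lb″)
                 (Any.there a∈p′) (Any.here refl)
             (λ a≡b″ → lower⇒≢ lb″ (≤-trans (n≤1+n _) (≤-reflexive (sym la))) (sym a≡b″))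

  parent-unique : ∀ {v w₁ w₂} → Adj v w₁ → Adj v w₂ →
                  level v ≡ suc (level w₁) → level v ≡ suc (level w₂) → w₁ ≡ w₂
  parent-unique {v} {w₁} e₁ e₂ l₁ l₂ =
    proj₁ (descents-meet (level w₁) ([]ₚ {v}) (All.[] ∷ []) (≤-reflexive (sym l₁) All.∷ All.[])
                         l₁ e₁ e₂ refl (suc-injective (trans (sym l₂) l₁)))

  has-parent : ∀ {y} → y ≢ x → ∃ λ y′ → Adj y y′ × level y ≡ suc (level y′)
  has-parent {y} y≢x with level y in ly
  ... | zero = ⊥-elim (y≢x (dist≡0⇒≡ ly))
  ... | suc k with y′ , e , ly′ ← dist-suc⇒adj ly = y′ , e , cong suc (sym ly′)

  adjacent-levels : ∀ {u w} → Adj u w →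
                    level u ≡ suc (level w) ⊎ level u ≡ level w ⊎ level w ≡ suc (level u)
  adjacent-levels {u} {w} e with <-cmp (level u) (level w)
  ... | tri< lu<lw _ _ = inj₂ (inj₂ (≤-antisym (adj⇒level≤ (adj-sym e)) lu<lw))
  ... | tri≈ _ lu≡lw _ = inj₂ (inj₁ lu≡lw)
  ... | tri> _ _ lw<lu = inj₁ (≤-antisym (adj⇒level≤ e) lw<lu)

  descent-∷-path-clique : ∀ {a b b′} (p : Path b a) → Unique (vertices p) →
                              All (λ y → level a ≤ level y) (vertices p) →
                              Adj b b′ → level a ≡ suc (level b′) → PairwiseAdjacent (b′ ∷ vertices p)
  descent-∷-path-clique {b′ = b′} p simple high bb′ la with a′ , aa′ , la′ ← dist-suc⇒adj la =
    proj₂ (descents-meet (level b′) p simple (All.map (λ {y} → subst (_≤ level y) la) high)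
                         la aa′ bb′ la′ refl)

  shared-parent : ∀ {u p q} → Adj u p → level u ≡ level p → Adj p q → level p ≡ suc (level q) →
                  Adj u q
  shared-parent up lu≡lp pq lp≡ =
    adj-sym (descent-∷-path-clique (adj-sym up ∷ₚ []ₚ) ((adj⇒≢ (adj-sym up) All.∷ All.[]) ∷ All.[] ∷ [])
                                   (≤-reflexive lu≡lp All.∷ ≤-refl All.∷ All.[]) pq lu≡
                                   (Any.here refl) (Any.there (Any.there (Any.here refl)))
                                   (lower⇒≢ refl (≤-reflexive (sym lu≡))))
    where
    lu≡ = trans lu≡lp lp≡

  level-triangle : ∀ {u p q} → Adj u p → Adj p q → u ≢ q → level u ≡ level p → level p ≡ level q →
                   Adj u q
  level-triangle {u} {p} {q} up pq u≢q lu≡lp lp≡lq = closes (has-parent u≢x)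
    where
    u≢x : u ≢ x
    u≢x refl = adj⇒≢ up (sym (dist≡0⇒≡ (trans (sym lu≡lp) (dist-refl x))))
    lq≡lu : level q ≡ level u
    lq≡lu = trans (sym lp≡lq) (sym lu≡lp)
    closes : (∃ λ u′ → Adj u u′ × level u ≡ suc (level u′)) → Adj u q
    closes (u′ , uu′ , lu≡) =
      descent-∷-path-clique (up ∷ₚ pq ∷ₚ []ₚ)
        ((adj⇒≢ up All.∷ u≢q All.∷ All.[]) ∷ (adj⇒≢ pq All.∷ All.[]) ∷ All.[] ∷ [])
        (≤-reflexive lq≡lu All.∷ ≤-reflexive (sym lp≡lq) All.∷ ≤-refl All.∷ All.[])
        uu′ (trans lq≡lu lu≡)
        (Any.there (Any.here refl)) (Any.there (Any.there (Any.there (Any.here refl)))) u≢q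

  -- u ≢ q and ¬ Adj u q say that the edges u p and p q lie in different blocks.
  level-rises : ∀ {u p q} → Adj u p → Adj p q → u ≢ q → ¬ Adj u q → level u ≤ level p →
                level q ≡ suc (level p)
  level-rises up pq u≢q u≁q lu≤lp with adjacent-levels pq | adjacent-levels up
  ... | inj₂ (inj₂ lq≡)   | _                 = lq≡
  ... | _                 | inj₁ lu≡          = ⊥-elim (<-irrefl refl (subst (_≤ _) lu≡ lu≤lp))
  ... | inj₁ lp≡          | inj₂ (inj₂ lp≡′)  = ⊥-elim (u≢q (parent-unique (adj-sym up) pq lp≡′ lp≡))
  ... | inj₁ lp≡          | inj₂ (inj₁ lu≡lp) = ⊥-elim (u≁q (shared-parent up lu≡lp pq lp≡))
  ... | inj₂ (inj₁ lp≡lq) | inj₂ (inj₂ lp≡)   =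
    ⊥-elim (u≁q (adj-sym (shared-parent (adj-sym pq) (sym lp≡lq) (adj-sym up) lp≡)))
  ... | inj₂ (inj₁ lp≡lq) | inj₂ (inj₁ lu≡lp) = ⊥-elim (u≁q (level-triangle up pq u≢q lu≡lp lp≡lq))

  level-along-geodesic : ∀ j {u p w} → Adj u p → dist G p w ≡ j → dist G u w ≡ suc j →
                   level u ≤ level p → level w ≡ level p + j
  level-along-geodesic zero up dpw duw lu≤lp with refl ← dist≡0⇒≡ dpw = sym (+-identityʳ _)
  level-along-geodesic (suc j) {u} {p} {w} up dpw duw lu≤lp with q , pq , dqw ← dist-suc⇒adj dpw =
    begin
      level w            ≡⟨ level-along-geodesic j pq dqw dpw lp≤lq ⟩
      level q + j        ≡⟨ cong (_+ j) lq ⟩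
      suc (level p) + j  ≡⟨ +-suc (level p) j ⟨
      level p + suc j    ∎
    where
    open ≡-Reasoning
    u≢q : u ≢ q
    u≢q refl with () ← trans (sym duw) dqw
    u≁q : ¬ Adj u q
    u≁q e = <-irrefl refl (subst (_≤ suc j) duw (subst (λ l → dist G u w ≤ suc l) dqw (dist-adj-≤ w e)))
    lq : level q ≡ suc (level p)
    lq = level-rises up pq u≢q u≁q lu≤lp
    lp≤lq : level p ≤ level q
    lp≤lq = ≤-trans (n≤1+n _) (≤-reflexive (sym lq))

module Eccentricity {n : ℕ} (G : Graph n) where

  dist≤ecc : ∀ {S v x} → x ∈ S → dist G v x ≤ ecc G S v
  dist≤ecc {S} {v} {x} x∈S =
    foldr-preservesᵒ {P = dist G v x ≤_} (λ a b → [ m≤n⇒m≤n⊔o b , m≤n⇒m≤o⊔n a ]′) 0 _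
      (inj₂ (Any.map⁺ (lose (∈-allFin x) (subst (λ b → dist G v x ≤ (if b then dist G v x else 0))
                                                  (sym ([]=⇒lookup x∈S)) ≤-refl))))

  ecc≤⁺ : ∀ {S v M} → (∀ x → x ∈ S → dist G v x ≤ M) → ecc G S v ≤ M
  ecc≤⁺ {S} {v} {M} bounded = foldr-preservesᵇ {P = _≤ M} ⊔-lub z≤n (All.map⁺ (All.tabulate⁺ term≤))
    where
    term≤ : ∀ x → (if lookup S x then dist G v x else 0) ≤ M
    term≤ x with lookup S x in x∈S
    ... | true  = bounded x (lookup⇒[]= x S x∈S)
    ... | false = z≤n

  ecc<⁺ : ∀ {S v M x₀} → x₀ ∈ S → (∀ x → x ∈ S → dist G v x < M) → ecc G S v < M
  ecc<⁺ {M = zero}  x₀∈S bounded with () ← bounded _ x₀∈S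
  ecc<⁺ {M = suc M} x₀∈S bounded = s≤s (ecc≤⁺ (λ x x∈S → ≤-pred (bounded x x∈S)))

  centerSet-by-threshold : ∀ {S A a m} → Nonempty S → a ∈ A →
                           (∀ v → v ∈ A → ecc G S v ≡ m) → (∀ v → v ∉ A → m < ecc G S v) →
                           IsCenterSet G A
  centerSet-by-threshold {S} {A} {a} {m} nonempty a∈A ecc∈ ecc∉ =
    S , nonempty , λ v → center⇐ v , center⇒ v
    where
    center⇐ : ∀ v → v ∈ A → InCenter G S v
    center⇐ v v∈A z with z ∈? A
    ... | yes z∈A = ≤-reflexive (trans (ecc∈ v v∈A) (sym (ecc∈ z z∈A)))
    ... | no z∉A = ≤-trans (≤-reflexive (ecc∈ v v∈A)) (<⇒≤ (ecc∉ z z∉A))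
    center⇒ : ∀ v → InCenter G S v → v ∈ A
    center⇒ v center with v ∈? A
    ... | yes v∈A = v∈A
    ... | no v∉A =
      ⊥-elim (<-irrefl refl (<-≤-trans (ecc∉ v v∉A) (≤-trans (center a) (≤-reflexive (ecc∈ a a∈A)))))

module Centers {n : ℕ} (G : Graph n) (connected : Connected G) (blockGraph : IsBlockGraph G)
               {S : Subset n} {x₀ : Fin n} (x₀∈S : x₀ ∈ S) where
  open Connectivity G
  open Distance G connected
  open Eccentricity G

  -- Stepping from u towards w lowers the eccentricity, by the level growth along geodesics.
  centers-adjacent : ∀ {u w} → InCenter G S u → InCenter G S w → u ≢ w → Adj u w
  centers-adjacent {u} {w} cu cw u≢w with dist G u w in duw
  ... | zero = ⊥-elim (u≢w (dist≡0⇒≡ duw))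
  ... | suc zero = dist≡1⇒adj duw
  ... | suc (suc j) with p , up , dpw ← dist-suc⇒adj duw =
    ⊥-elim (<-irrefl refl (<-≤-trans (ecc<⁺ x₀∈S closer) (cu p)))
    where
    closer : ∀ x → x ∈ S → dist G p x < ecc G S u
    closer x x∈S with dist G u x ≤? dist G p x
    ... | no ux≰px = <-≤-trans (≰⇒> ux≰px) (dist≤ecc x∈S)
    ... | yes ux≤px = begin-strict
        dist G p x            <⟨ m<m+n (dist G p x) (s≤s z≤n) ⟩
        dist G p x + suc j    ≡⟨ level-along-geodesic (suc j) up dpw duw ux≤px ⟨
        dist G w x            ≤⟨ dist≤ecc x∈S ⟩
        ecc G S w             ≤⟨ cw u ⟩
        ecc G S u             ∎
      where
      open Levels G connected blockGraph x
      open ≤-Reasoning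

  common-neighbor-center : ∀ {u w y} → InCenter G S u → InCenter G S w → Adj u w →
                            Adj y u → Adj y w → InCenter G S y
  common-neighbor-center {u} {w} {y} cu cw uw yu yw z = ≤-trans (ecc≤⁺ bounded) (cu z)
    where
    bounded : ∀ x → x ∈ S → dist G y x ≤ ecc G S u
    bounded x x∈S with dist G y x ≤? ecc G S u
    ... | yes yx≤ = yx≤
    ... | no yx≰ = ⊥-elim (adj⇒≢ uw (parent-unique yu yw (above u (dist≤ecc x∈S) yu)
                                                        (above w (≤-trans (dist≤ecc x∈S) (cw u)) yw)))
      where
      open Levels G connected blockGraph x
      above : ∀ v → level v ≤ ecc G S u → Adj y v → level y ≡ suc (level v)
      above v lv≤ yv = ≤-antisym (adj⇒level≤ yv) (≤-trans (s≤s lv≤) (≰⇒> yx≰))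

module CenterSets {n : ℕ} (G : Graph (suc n)) (connected : Connected G) (blockGraph : IsBlockGraph G)
  where
  open Connectivity G
  open BlockGraph G blockGraph
  open Distance G connected
  open Eccentricity G

  center-exists : ∀ S → ∃ (InCenter G S)
  center-exists S =
    argmin (ecc G S) zero (allFin (suc n)) ,
    λ y → All.lookup (f[argmin]≤f[xs] {f = ecc G S} zero (allFin (suc n))) (∈-allFin y)

  singleton-centerSet : ∀ v → IsCenterSet G ⁅ v ⁆
  singleton-centerSet v = centerSet-by-threshold (v , x∈⁅x⁆ v) (x∈⁅x⁆ v) ecc∈ ecc∉
    where
    ecc∈ : ∀ u → u ∈ ⁅ v ⁆ → ecc G ⁅ v ⁆ u ≡ 0
    ecc∈ u u∈ with refl ← x∈⁅y⁆⇒x≡y v u∈ =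
      n≤0⇒n≡0 (ecc≤⁺ λ x x∈ → subst (λ x → dist G v x ≤ 0) (sym (x∈⁅y⁆⇒x≡y v x∈))
                                    (≤-reflexive (dist-refl v)))
    ecc∉ : ∀ u → u ∉ ⁅ v ⁆ → 0 < ecc G ⁅ v ⁆ u
    ecc∉ u u∉ = <-≤-trans (≢⇒dist>0 λ { refl → u∉ (x∈⁅x⁆ v) }) (dist≤ecc (x∈⁅x⁆ v))

  block-nonempty : ∀ {A} → IsBlock G A → Nonempty A
  block-nonempty {A} block with nonempty? A
  ... | yes nonempty = nonempty
  ... | no empty = ⊥-elim (empty (zero , proj₂ (block⇒maximalClique block) zero
                                           λ a a∈A → ⊥-elim (empty (a , a∈A))))

  block-centerSet : ∀ {A} → IsBlock G A → IsCenterSet G A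
  block-centerSet {A} block with block-nonempty block
  ... | u , u∈A with singleton⊎another u∈A
  ... | inj₁ refl = singleton-centerSet u
  ... | inj₂ (w , w∈A , w≢u) = centerSet-by-threshold (u , u∈A) u∈A ecc∈ ecc∉
    where
    clique : Clique A
    clique = proj₁ (block⇒maximalClique block)
    another : ∀ a → ∃ λ b → b ∈ A × a ≢ b
    another a with a ≟ u
    ... | yes refl = w , w∈A , λ e → w≢u (sym e)
    ... | no a≢u = u , u∈A , a≢u
    ecc∈ : ∀ a → a ∈ A → ecc G A a ≡ 1
    ecc∈ a a∈A with b , b∈A , a≢b ← another a =
      ≤-antisym (ecc≤⁺ λ x x∈A → ≡⊎adj⇒dist≤1 (clique⇒≡⊎adj clique a∈A x∈A))
                (<-≤-trans (≢⇒dist>0 a≢b) (dist≤ecc b∈A))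
    ecc∉ : ∀ y → y ∉ A → 1 < ecc G A y
    ecc∉ y y∉A
      with a , a∈A , y≢a , y≁a ← nonNeighbor (λ y~A → y∉A (proj₂ (block⇒maximalClique block) y y~A)) =
      ≤-trans (≢∧¬adj⇒dist≥2 y≢a y≁a) (dist≤ecc a∈A)

  centerSet⇒singleton⊎block : ∀ {A} → IsCenterSet G A → (∃ λ v → A ≡ ⁅ v ⁆) ⊎ IsBlock G A
  centerSet⇒singleton⊎block {A} (S , (x₀ , x₀∈S) , center⇔) =
    [ (λ A≡⁅u⁆ → inj₁ (u , A≡⁅u⁆)) , (λ (w , w∈A , w≢u) → inj₂ (block w∈A w≢u)) ]′
      (singleton⊎another u∈A)
    where
    open Centers G connected blockGraph x₀∈S
    u : Fin (suc n)
    u = proj₁ (center-exists S)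
    center : ∀ {v} → v ∈ A → InCenter G S v
    center {v} = proj₁ (center⇔ v)
    u∈A : u ∈ A
    u∈A = proj₂ (center⇔ u) (proj₂ (center-exists S))
    clique : Clique A
    clique a b a∈A b∈A = centers-adjacent (center a∈A) (center b∈A)
    block : ∀ {w} → w ∈ A → w ≢ u → IsBlock G A
    block {w} w∈A w≢u = maximalClique⇒block (clique , grow)
      where
      grow : ∀ y → AdjacentToAll A y → y ∈ A
      grow y y~A = by-cases (y ≟ u) (y ≟ w)
        where
        by-cases : Dec (y ≡ u) → Dec (y ≡ w) → y ∈ A
        by-cases (yes y≡u) _ = subst (_∈ A) (sym y≡u) u∈A
        by-cases _ (yes y≡w) = subst (_∈ A) (sym y≡w) w∈A
        by-cases (no y≢u) (no y≢w) = proj₂ (center⇔ y)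
          (common-neighbor-center (center u∈A) (center w∈A) (clique u w u∈A w∈A (λ e → w≢u (sym e)))
                                   (y~A u u∈A y≢u) (y~A w w∈A y≢w))

mainTheorem3 : (n : ℕ) (G : Graph (suc n)) → Connected G → IsBlockGraph G →
    (A : Subset (suc n)) →
      (IsCenterSet G A → (∃ λ v → A ≡ ⁅ v ⁆) ⊎ IsBlock G A)
      × ((∃ λ v → A ≡ ⁅ v ⁆) ⊎ IsBlock G A → IsCenterSet G A)
mainTheorem3 n G connected blockGraph A =
  centerSet⇒singleton⊎block ,
  [ (λ { (v , refl) → singleton-centerSet v }) , block-centerSet ]′
  where open CenterSets G connected blockGraph
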